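{- Let $R$ be a unique factorization domain, let $k\ge2$ and $n$ be integers such that some prime factor of $n$ has multiplicity at least $k$ in $n$, and let $q_k$ be the smallest prime factor of $n$ with multiplicity $\ge k$. Let $f(s)=\sum_{i=1}^n\frac{a_i}{i^s}$ be a Dirichlet polynomial of degree $n$ with coefficients in $R$. If $f$ has a nonzero coefficient $a_i$ with $n-\min\{n_{<k},q_k\}\,q_k^{k-1}<i<n$, then $f$ is $k$-power-free.
   Context: Dirichlet polynomials are multiplied by the Dirichlet product $\left(\sum_j\frac{b_j}{j^s}\right)\left(\sum_k\frac{c_k}{k^s}\right)=\sum_i\frac{\sum_{jk=i}b_jc_k}{i^s}$; constant means supported on $\{1\}$; the degree is the largest index with nonzero coefficient. $n_{<k}=\prod_{p \text{ prime},\ \nu_p(n)<k}p^{\nu_p(n)}$ (empty product $=1$), where $\nu_p$ is the $p$-adic valuation. $f$ is called $k$-power-free if each nonconstant irreducible factor of $f$ occurs with multiplicity at most $k-1$ in the factorization of $f$ (equivalently, no $g^k$ with $g$ a nonconstant Dirichlet polynomial over $R$ divides $f$). -}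

module Defs where

open import Level using (_⊔_)
open import Data.Bool using (Bool; true; false; if_then_else_; _∧_)
open import Data.Nat using (ℕ; zero; suc; _<_; _≤_; _<ᵇ_; _^_; _/_)
import Data.Nat.Divisibility as ℕᵈ
open import Data.Nat.Primality using (prime?)
open import Data.List using (List; map; upTo; foldr)
open import Data.Nat.ListAction using () renaming (product to productℕ)
open import Data.List.Relation.Unary.All using (All)
open import Data.Product using (∃; _×_)
open import Data.Sum using (_⊎_)
open import Relation.Nullary using (¬_; does)
open import Algebra.Bundles using (CommutativeRing; Semiring)
import Algebra.Definitions.RawSemiring as RS

-- Computed with fuel n, which is
-- enough since ν p n ≤ log₂ n < n.  (Values for p < 2 or n = 0 are
-- irrelevant and set to 0.)

ν : ℕ → ℕ → ℕ
ν zero n = 0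
ν (suc zero) n = 0
ν p@(suc (suc _)) n = go n n
  where
  go : ℕ → ℕ → ℕ
  go zero m = 0
  go (suc fuel) zero = 0
  go (suc fuel) m@(suc _) = if does (p ℕᵈ.∣? m) then suc (go fuel (m / p)) else 0

-- n_{<k} = ∏_{p prime, ν_p(n) < k} p^{ν_p(n)}.
-- Primes not dividing n contribute p^0 = 1, and primes dividing n
-- (n ≥ 1) are ≤ n, so it suffices to range over p ∈ {0,…,n}.

nBelow : ℕ → ℕ → ℕ
nBelow k n =
  productℕ (map (λ p → if does (prime? p) ∧ (ν p n <ᵇ k) then p ^ ν p n else 1)
                 (upTo (suc n)))

record IsUFD {c ℓ} (R : CommutativeRing c ℓ) : Set (c ⊔ ℓ) where
  open CommutativeRing R
  open RS (Semiring.rawSemiring semiring) using (_∣_; Irreducible; Prime)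
  field
    1≉0            : ¬ (1# ≈ 0#)
    noZeroDivisors : ∀ x y → x * y ≈ 0# → x ≈ 0# ⊎ y ≈ 0#
    factorization  : ∀ x → ¬ (x ≈ 0#) → ¬ (x ∣ 1#) →
                     ∃ λ (ps : List Carrier) → All Irreducible ps × foldr _*_ 1# ps ≈ x
    irreducible⇒prime : ∀ p → Irreducible p → Prime p

-- Dirichlet series / polynomials over R, as coefficient functions
-- a : ℕ → R, a i being the coefficient of i^{-s}.  The coefficient at
-- index 0 is meaningless and ignored everywhere.

module DP {c ℓ} (R : CommutativeRing c ℓ) where
  open CommutativeRing R

  Series : Set c
  Series = ℕ → Carrier

  sumTo : (ℕ → Carrier) → ℕ → Carrier
  sumTo f zero = 0#
  sumTo f (suc m) = sumTo f m + f m

  -- Dirichlet product: (b ⋆ d) i = Σ_{j k = i} b j * d k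
  --                              = Σ_{j=1}^{i} [j ∣ i] b j * d (i / j)
  _⋆_ : Series → Series → Series
  (b ⋆ d) i = sumTo (λ m → if does (suc m ℕᵈ.∣? i) then b (suc m) * d (i / suc m) else 0#) i

  one : Series
  one (suc zero) = 1#
  one _ = 0#

  _^⋆_ : Series → ℕ → Series
  g ^⋆ zero = one
  g ^⋆ suc k = g ⋆ (g ^⋆ k)

  _≈D_ : Series → Series → Set ℓ
  a ≈D b = ∀ i → 1 ≤ i → a i ≈ b i

  IsDirichletPolynomial : Series → Set ℓ
  IsDirichletPolynomial a = ∃ λ N → ∀ i → N < i → a i ≈ 0#

  Constant : Series → Set ℓ
  Constant a = ∀ i → 2 ≤ i → a i ≈ 0#

  HasDegree : Series → ℕ → Set ℓ
  HasDegree a n = ¬ (a n ≈ 0#) × (∀ i → n < i → a i ≈ 0#)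

  PowerFree : ℕ → Series → Set (c ⊔ ℓ)
  PowerFree k f =
    ¬ (∃ λ g → IsDirichletPolynomial g × ¬ Constant g ×
         ∃ λ h → IsDirichletPolynomial h × ((g ^⋆ k) ⋆ h) ≈D f)

-- If f = g ^ k ⋆ h with deg g = d ≥ 2 and deg h = e, then f has degree n = d ^ k · e, and the
-- top term of g ^ k is isolated: g ^ k has no terms strictly between d ^ k − d ^ (k − 1) and d ^ k.
-- Hence all coefficients of f with index strictly between n − min(d ^ (k − 1) · e, d ^ k) and n
-- vanish. Every prime factor p of d has p ^ k ∣ n, so q ≤ d, and no prime of n_{<k} divides d,
-- so n_{<k} ∣ e. The window min(n_{<k}, q) · q ^ (k − 1) of the hypothesis therefore lies inside
-- the vanishing range, contradicting the nonzero coefficient it contains.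

module Submission where

open import Defs
open import Algebra.Bundles using (CommutativeRing)
open import Data.Bool using (T; true; false; if_then_else_; _∧_)
open import Data.List using ([]; _∷_; map)
open import Data.List.Relation.Unary.All as All using (All; []; _∷_)
import Data.List.Relation.Unary.All.Properties as All
open import Data.List.Relation.Unary.Unique.Propositional using (Unique; []; _∷_)
open import Data.List.Relation.Unary.Unique.Propositional.Properties using (upTo⁺)
open import Data.Nat using (ℕ; zero; suc; _+_; _*_; _∸_; _^_; _<_; _≤_; _⊓_; _/_; _<ᵇ_; z≤n; s≤s; z<s; NonZero; >-nonZero; >-nonZero⁻¹)
open import Data.Nat.Coprimality using (Coprime; coprime-divisor)
open import Data.Nat.Divisibility
open import Data.Nat.DivMod using (m≥n⇒m/n>0; m*[n/m]≡n; m*n/n≡m)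
open import Data.Nat.ListAction using (product)
open import Data.Nat.Primality using (Prime; prime?; euclidsLemma; prime⇒irreducible; prime[2]; ¬prime[1])
open import Data.Nat.Primality.Factorisation using (factorise)
open import Data.Nat.Properties
open import Data.Product using (∃; ∃-syntax; _×_; _,_; proj₁; proj₂)
open import Data.Sum using (_⊎_; inj₁; inj₂; [_,_]′)
open import Data.Unit using (tt)
open import Function using (_∘_)
open import Relation.Binary.Definitions using (tri<; tri≈; tri>)
open import Relation.Binary.PropositionalEquality using (_≡_; _≢_; refl; sym; trans; cong; subst)
open import Relation.Nullary using (¬_; Dec; does; yes; no; contradiction)
open import Relation.Nullary.Decidable using (¬¬-excluded-middle)

n<m^n : ∀ {m} → 1 < m → ∀ n → n < m ^ n
n<m^n 1<m zero = s≤s z≤n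
n<m^n {m@(suc _)} 1<m (suc n) = begin-strict
  suc n      ≤⟨ n<m^n 1<m n ⟩
  m ^ n      <⟨ m<m*n (m ^ n) m 1<m ⟩
  m ^ n * m  ≡⟨ *-comm (m ^ n) m ⟩
  m ^ suc n  ∎
  where open ≤-Reasoning
        instance _ = >-nonZero (m^n>0 m n)

if-does-elim : ∀ {a b p} {A : Set a} {B : Set b} (P : B → Set p) (d : Dec A) {t e : B} →
               (A → P t) → (¬ A → P e) → P (if does d then t else e)
if-does-elim P (yes a) on-yes _     = on-yes a
if-does-elim P (no ¬a) _     on-no = on-no ¬a

-- The fuelled loop `go` of ν is local to its where block. The metavariable ν-loop is solved to
-- that loop by ν-unfold, after which ν (2 + a) n unfolds definitionally to ν-loop a n n n.
mutual
  ν-loop : ℕ → ℕ → ℕ → ℕ → ℕ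
  ν-loop = _

  ν-unfold : ∀ a N → ν (2 + a) (suc N) ≡
             (if does (2 + a ∣? suc N) then suc (ν-loop a (suc N) N (suc N / (2 + a))) else 0)
  ν-unfold a N with does (2 + a ∣? suc N) | suc N / (2 + a) | suc N
  ... | _ | _ | _ = refl

module _ (a N : ℕ) where

  private
    p = 2 + a

  ν-loop-∣ : ∀ fuel m → p ^ ν-loop a N fuel m ∣ m
  ν-loop-∣ zero       m       = 1∣ m
  ν-loop-∣ (suc fuel) zero    = 1∣ 0
  ν-loop-∣ (suc fuel) (suc m) = if-does-elim (λ v → p ^ v ∣ suc m) (p ∣? suc m)
    (λ p∣m → m∣n/o⇒o*m∣n p∣m (ν-loop-∣ fuel (suc m / p)))
    (λ _ → 1∣ suc m)

  ν-loop-≥ : ∀ fuel m j → .{{NonZero m}} → j ≤ fuel → p ^ j ∣ m → j ≤ ν-loop a N fuel m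
  ν-loop-≥ fuel       m       zero    _         _       = z≤n
  ν-loop-≥ (suc fuel) (suc m) (suc j) (s≤s j≤f) pʲ⁺¹∣m = if-does-elim (suc j ≤_) (p ∣? suc m)
    (λ p∣m → s≤s (ν-loop-≥ fuel (suc m / p) j {{>-nonZero (m≥n⇒m/n>0 (∣⇒≤ p∣m))}} j≤f
                              (m*n∣o⇒n∣o/m p (p ^ j) pʲ⁺¹∣m)))
    (contradiction (m*n∣⇒m∣ p (p ^ j) pʲ⁺¹∣m))

^ν∣ : ∀ {p} n → Prime p → p ^ ν p n ∣ n
^ν∣ {suc (suc a)} n _ = ν-loop-∣ a n n n

^∣⇒≤ν : ∀ {p n j} → .{{NonZero n}} → Prime p → p ^ j ∣ n → j ≤ ν p n
^∣⇒≤ν {suc (suc a)} {n} {j} _ pʲ∣n =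
  ν-loop-≥ a n n n j (<⇒≤ (<-≤-trans (n<m^n (s≤s (s≤s z≤n)) j) (∣⇒≤ pʲ∣n))) pʲ∣n

prime∤1 : ∀ {p} → Prime p → p ∤ 1
prime∤1 p-prime p∣1 = ¬prime[1] (subst Prime (∣1⇒≡1 p∣1) p-prime)

prime∣prime⇒≡ : ∀ {p q} → Prime p → Prime q → p ∣ q → p ≡ q
prime∣prime⇒≡ p-prime q-prime p∣q with prime⇒irreducible q-prime p∣q
... | inj₁ refl = contradiction p-prime ¬prime[1]
... | inj₂ p≡q  = p≡q

prime∣^⇒∣ : ∀ {p m} v → Prime p → p ∣ m ^ v → p ∣ m
prime∣^⇒∣         zero    p-prime p∣1      = contradiction p∣1 (prime∤1 p-prime)
prime∣^⇒∣ {m = m} (suc v) p-prime p∣m^v+1 with euclidsLemma m (m ^ v) p-prime p∣m^v+1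
... | inj₁ p∣m   = p∣m
... | inj₂ p∣m^v = prime∣^⇒∣ v p-prime p∣m^v

^-monoˡ-∣ : ∀ {m n} k → m ∣ n → m ^ k ∣ n ^ k
^-monoˡ-∣ zero    _   = ∣-refl
^-monoˡ-∣ (suc k) m∣n = *-pres-∣ m∣n (^-monoˡ-∣ k m∣n)

prime-factor : ∀ {n} → n ≢ 1 → ∃[ p ] Prime p × p ∣ n
prime-factor {zero}        _   = 2 , prime[2] , 2 ∣0
prime-factor {suc zero}    n≢1 = contradiction refl n≢1
prime-factor {n@(suc (suc _))} _ with factorise n
... | record { factors = p ∷ ps ; isFactorisation = n≡p*ps ; factorsPrime = p-prime ∷ _ } =
  p , p-prime , divides (product ps) (trans n≡p*ps (*-comm p (product ps)))

¬common-prime⇒coprime : ∀ {m n} → (∀ {p} → Prime p → p ∣ m → p ∤ n) → Coprime m n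
¬common-prime⇒coprime no-common {i} (i∣m , i∣n) with i ≟ 1
... | yes i≡1 = i≡1
... | no  i≢1 with prime-factor i≢1
...   | p , p-prime , p∣i = contradiction (∣-trans p∣i i∣n) (no-common p-prime (∣-trans p∣i i∣m))

coprime⇒*-∣ : ∀ {m n o} → Coprime m n → m ∣ o → n ∣ o → m * n ∣ o
coprime⇒*-∣ {m} {n} coprime m∣t*n (divides t refl) =
  *-monoˡ-∣ n (coprime-divisor coprime (subst (m ∣_) (*-comm t n) m∣t*n))

prime∤product : ∀ {p ms} → Prime p → All (p ∤_) ms → p ∤ product ms
prime∤product p-prime []             = prime∤1 p-prime
prime∤product {ms = m ∷ ms} p-prime (p∤m ∷ p∤ms) p∣m*ms with euclidsLemma m (product ms) p-prime p∣m*ms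
... | inj₁ p∣m  = p∤m p∣m
... | inj₂ p∣ms = prime∤product p-prime p∤ms p∣ms

product-map-∣ : ∀ {e xs} (F : ℕ → ℕ) → (∀ x → F x ∣ e) → (∀ {p} x → Prime p → p ∣ F x → p ≡ x) →
                Unique xs → product (map F xs) ∣ e
product-map-∣ F F∣e support []                = 1∣ _
product-map-∣ F F∣e support (_∷_ {x} {xs} x∉xs xs-unique) =
  coprime⇒*-∣ coprime (F∣e x) (product-map-∣ F F∣e support xs-unique)
  where
  coprime : Coprime (F x) (product (map F xs))
  coprime = ¬common-prime⇒coprime λ p-prime p∣Fx → prime∤product p-prime (All.map⁺ (All.map
    (λ {y} x≢y p∣Fy → x≢y (trans (sym (support x p-prime p∣Fx)) (support y p-prime p∣Fy))) x∉xs))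

nBelowFactor : ℕ → ℕ → ℕ → ℕ
nBelowFactor k n p = if does (prime? p) ∧ (ν p n <ᵇ k) then p ^ ν p n else 1

nBelowFactor-cases : ∀ k n p → nBelowFactor k n p ≡ 1 ⊎ Prime p × ν p n < k × nBelowFactor k n p ≡ p ^ ν p n
nBelowFactor-cases k n p with prime? p | ν p n <ᵇ k in ν<ᵇk
... | no  _       | _     = inj₁ refl
... | yes _       | false = inj₁ refl
... | yes p-prime | true  = inj₂ (p-prime , <ᵇ⇒< (ν p n) k (subst T (sym ν<ᵇk) tt) , refl)

nBelow-∣ : ∀ {k n D e} → .{{NonZero n}} → n ≡ D * e → (∀ {p} → Prime p → p ∣ D → p ^ k ∣ n) →
           nBelow k n ∣ e
nBelow-∣ {k} {n} {D} {e} n≡D*e D-primes =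
  product-map-∣ (nBelowFactor k n) factor-∣ factor-support (upTo⁺ (suc n))
  where
  factor-support : ∀ {p} x → Prime p → p ∣ nBelowFactor k n x → p ≡ x
  factor-support x p-prime p∣F with nBelowFactor-cases k n x
  ... | inj₁ F≡1 = contradiction (subst (_ ∣_) F≡1 p∣F) (prime∤1 p-prime)
  ... | inj₂ (x-prime , _ , F≡x^ν) =
    prime∣prime⇒≡ p-prime x-prime (prime∣^⇒∣ (ν x n) p-prime (subst (_ ∣_) F≡x^ν p∣F))

  factor-∣ : ∀ x → nBelowFactor k n x ∣ e
  factor-∣ x with nBelowFactor-cases k n x
  ... | inj₁ F≡1 = subst (_∣ e) (sym F≡1) (1∣ e)
  ... | inj₂ (x-prime , ν<k , F≡x^ν) =
    subst (_∣ e) (sym F≡x^ν) (coprime-divisor coprime (subst (x ^ ν x n ∣_) n≡D*e (^ν∣ n x-prime)))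
    where
    coprime : Coprime (x ^ ν x n) D
    coprime = ¬common-prime⇒coprime λ {p} p-prime p∣x^ν p∣D →
      let p≡x = prime∣prime⇒≡ p-prime x-prime (prime∣^⇒∣ (ν x n) p-prime p∣x^ν)
      in <⇒≱ ν<k (^∣⇒≤ν x-prime (D-primes x-prime (subst (_∣ D) p≡x p∣D)))

least-prime-≤ : ∀ {k n q d} → (∀ p → Prime p → p ^ k ∣ n → q ≤ p) → 1 < d → d ^ k ∣ n → q ≤ d
least-prime-≤ {k} {d = d@(suc _)} q-least 1<d dᵏ∣n with prime-factor (>⇒≢ 1<d)
... | p , p-prime , p∣d = ≤-trans (q-least p p-prime (∣-trans (^-monoˡ-∣ k p∣d) dᵏ∣n)) (∣⇒≤ p∣d)

gap-width-bounds : ∀ {K n q d e} → .{{NonZero n}} → .{{NonZero e}} → n ≡ d ^ suc K * e → 1 < d →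
                   (∀ p → Prime p → p ^ suc K ∣ n → q ≤ p) →
                   (nBelow (suc K) n ⊓ q) * q ^ K ≤ d ^ K * e × (nBelow (suc K) n ⊓ q) * q ^ K ≤ d ^ suc K
gap-width-bounds {K} {n} {q} {d} {e} n≡dᵏ*e 1<d q-least =
  ≤-trans (*-mono-≤ (≤-trans (m⊓n≤m (nBelow (suc K) n) q) nBelow≤e) qᴷ≤dᴷ) (≤-reflexive (*-comm e (d ^ K))) ,
  *-mono-≤ (≤-trans (m⊓n≤n (nBelow (suc K) n) q) q≤d) qᴷ≤dᴷ
  where
  dᵏ∣n : d ^ suc K ∣ n
  dᵏ∣n = divides e (trans n≡dᵏ*e (*-comm (d ^ suc K) e))

  q≤d : q ≤ d
  q≤d = least-prime-≤ {suc K} q-least 1<d dᵏ∣n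

  qᴷ≤dᴷ : q ^ K ≤ d ^ K
  qᴷ≤dᴷ = ^-monoˡ-≤ K q≤d

  nBelow≤e : nBelow (suc K) n ≤ e
  nBelow≤e = ∣⇒≤ (nBelow-∣ {suc K} {D = d ^ suc K} n≡dᵏ*e λ p-prime p∣dᵏ →
                   ∣-trans (^-monoˡ-∣ (suc K) (prime∣^⇒∣ {m = d} (suc K) p-prime p∣dᵏ)) dᵏ∣n)

module DirichletDegree {c ℓ} (R : CommutativeRing c ℓ) where

  private module R = CommutativeRing R
  open R using (_≈_; 0#; 1#) renaming (_*_ to _·_)
  open DP R

  VanishesAbove : Series → ℕ → Set ℓ
  VanishesAbove a A = ∀ i → A < i → a i ≈ 0#

  GapBelow : Series → ℕ → ℕ → Set ℓ
  GapBelow a A γ = ∀ j → A < γ + j → j < A → a j ≈ 0#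

  ≤-or-≈0 : ∀ {a A} → VanishesAbove a A → ∀ x → x ≤ A ⊎ a x ≈ 0#
  ≤-or-≈0 {A = A} a↑ x with x ≤? A
  ... | yes x≤A = inj₁ x≤A
  ... | no  x≰A = inj₂ (a↑ x (≰⇒> x≰A))

  ·≈0 : ∀ {x y} → x ≈ 0# ⊎ y ≈ 0# → x · y ≈ 0#
  ·≈0 (inj₁ x≈0) = R.trans (R.*-cong x≈0 R.refl) (R.zeroˡ _)
  ·≈0 (inj₂ y≈0) = R.trans (R.*-cong R.refl y≈0) (R.zeroʳ _)

  sumTo-≈0 : ∀ t M → (∀ m → m < M → t m ≈ 0#) → sumTo t M ≈ 0#
  sumTo-≈0 t zero    _   = R.refl
  sumTo-≈0 t (suc M) t≈0 =
    R.trans (R.+-cong (sumTo-≈0 t M (λ m m<M → t≈0 m (m<n⇒m<1+n m<M))) (t≈0 M (n<1+n M))) (R.+-identityʳ 0#)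

  sumTo-single : ∀ t M m₀ → m₀ < M → (∀ m → m < M → m ≢ m₀ → t m ≈ 0#) → sumTo t M ≈ t m₀
  sumTo-single t (suc M) m₀ m₀<1+M others with m₀ ≟ M
  ... | yes refl =
    R.trans (R.+-cong (sumTo-≈0 t M (λ m m<M → others m (m<n⇒m<1+n m<M) (<⇒≢ m<M))) R.refl) (R.+-identityˡ _)
  ... | no m₀≢M =
    R.trans (R.+-cong (sumTo-single t M m₀ (≤∧≢⇒< (m<1+n⇒m≤n m₀<1+M) m₀≢M)
                                  (λ m m<M → others m (m<n⇒m<1+n m<M)))
                    (others M (n<1+n M) (m₀≢M ∘ sym)))
            (R.+-identityʳ _)

  ⋆-≈0 : ∀ a b i → (∀ x y → x * y ≡ i → a x ≈ 0# ⊎ b y ≈ 0#) → (a ⋆ b) i ≈ 0#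
  ⋆-≈0 a b i vanish = sumTo-≈0 _ i λ m _ → if-does-elim (_≈ 0#) (suc m ∣? i)
    (λ m+1∣i → ·≈0 (vanish (suc m) (i / suc m) (m*[n/m]≡n m+1∣i)))
    (λ _ → R.refl)

  ⋆-single : ∀ a b x₀ y₀ .{{_ : NonZero x₀}} .{{_ : NonZero y₀}} →
             (∀ x y → x * y ≡ x₀ * y₀ → x ≢ x₀ → a x ≈ 0# ⊎ b y ≈ 0#) → (a ⋆ b) (x₀ * y₀) ≈ a x₀ · b y₀
  ⋆-single a b x₀@(suc m₀) y₀ others =
    R.trans (sumTo-single _ (x₀ * y₀) m₀ (∣⇒≤ {{m*n≢0 x₀ y₀}} x₀∣x₀y₀) other-terms) main-term
    where
    x₀∣x₀y₀ : x₀ ∣ x₀ * y₀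
    x₀∣x₀y₀ = m∣m*n y₀

    other-terms : ∀ m → m < x₀ * y₀ → m ≢ m₀ →
                  (if does (suc m ∣? x₀ * y₀) then a (suc m) · b (x₀ * y₀ / suc m) else 0#) ≈ 0#
    other-terms m _ m≢m₀ = if-does-elim (_≈ 0#) (suc m ∣? x₀ * y₀)
      (λ m+1∣x₀y₀ → ·≈0 (others (suc m) _ (m*[n/m]≡n m+1∣x₀y₀) (m≢m₀ ∘ suc-injective)))
      (λ _ → R.refl)

    main-term : (if does (x₀ ∣? x₀ * y₀) then a x₀ · b (x₀ * y₀ / x₀) else 0#) ≈ a x₀ · b y₀
    main-term = if-does-elim (_≈ a x₀ · b y₀) (x₀ ∣? x₀ * y₀)
      (λ _ → R.*-cong R.refl (R.reflexive (cong b (trans (cong (_/ x₀) (*-comm x₀ y₀)) (m*n/n≡m y₀ x₀)))))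
      (contradiction x₀∣x₀y₀)

  one-vanishesAbove : VanishesAbove one 1
  one-vanishesAbove (suc (suc _)) _         = R.refl
  one-vanishesAbove (suc zero)    (s≤s ())

  ⋆-vanishesAbove : ∀ {a b A B} → VanishesAbove a A → VanishesAbove b B → VanishesAbove (a ⋆ b) (A * B)
  ⋆-vanishesAbove {a} {b} a↑ b↑ i AB<i = ⋆-≈0 a b i vanish
    where
    vanish : ∀ x y → x * y ≡ i → a x ≈ 0# ⊎ b y ≈ 0#
    vanish x y refl with ≤-or-≈0 a↑ x | ≤-or-≈0 b↑ y
    ... | inj₂ ax≈0 | _         = inj₁ ax≈0
    ... | _         | inj₂ by≈0 = inj₂ by≈0
    ... | inj₁ x≤A  | inj₁ y≤B  = contradiction AB<i (≤⇒≯ (*-mono-≤ x≤A y≤B))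

  ^⋆-vanishesAbove : ∀ {g d} → VanishesAbove g d → ∀ k → VanishesAbove (g ^⋆ k) (d ^ k)
  ^⋆-vanishesAbove g↑ zero    = one-vanishesAbove
  ^⋆-vanishesAbove g↑ (suc k) = ⋆-vanishesAbove g↑ (^⋆-vanishesAbove g↑ k)

  ⋆-top : ∀ {a b A B} .{{_ : NonZero A}} .{{_ : NonZero B}} → VanishesAbove a A → VanishesAbove b B →
          (a ⋆ b) (A * B) ≈ a A · b B
  ⋆-top {a} {b} {A} {B} a↑ b↑ = ⋆-single a b A B others
    where
    others : ∀ x y → x * y ≡ A * B → x ≢ A → a x ≈ 0# ⊎ b y ≈ 0#
    others x y xy≡AB x≢A with ≤-or-≈0 a↑ x | ≤-or-≈0 b↑ y
    ... | inj₂ ax≈0 | _         = inj₁ ax≈0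
    ... | _         | inj₂ by≈0 = inj₂ by≈0
    ... | inj₁ x≤A  | inj₁ y≤B  =
      contradiction xy≡AB (<⇒≢ (≤-<-trans (*-monoʳ-≤ x y≤B) (*-monoˡ-< B (≤∧≢⇒< x≤A x≢A))))

  hasDegree-unique : ∀ {a b A B} .{{_ : NonZero A}} .{{_ : NonZero B}} →
                     a ≈D b → HasDegree a A → HasDegree b B → A ≡ B
  hasDegree-unique {A = A} {B} a≈b (aA≉0 , a↑) (bB≉0 , b↑) with <-cmp A B
  ... | tri< A<B _ _ = contradiction (R.trans (R.sym (a≈b B (>-nonZero⁻¹ B))) (a↑ B A<B)) bB≉0
  ... | tri≈ _ A≡B _ = A≡B
  ... | tri> _ _ B<A = contradiction (R.trans (a≈b A (>-nonZero⁻¹ A)) (b↑ A B<A)) aA≉0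

  vanishesAbove-≈D : ∀ {a b A} → a ≈D b → VanishesAbove a A → VanishesAbove b A
  vanishesAbove-≈D a≈b a↑ i A<i = R.trans (R.sym (a≈b i (≤-<-trans z≤n A<i))) (a↑ i A<i)

  gapBelow-1 : ∀ a A → GapBelow a A 1
  gapBelow-1 a A j A<1+j j<A = contradiction j<A (≤⇒≯ (m<1+n⇒m≤n A<1+j))

  gapBelow-≈D : ∀ {a b A γ} → a ≈D b → γ ≤ A → GapBelow a A γ → GapBelow b A γ
  gapBelow-≈D {A = A} {γ} a≈b γ≤A a-gap zero A<γ+0 _ =
    contradiction (subst (A <_) (+-identityʳ γ) A<γ+0) (≤⇒≯ γ≤A)
  gapBelow-≈D a≈b γ≤A a-gap j@(suc _) A<γ+j j<A = R.trans (R.sym (a≈b j (s≤s z≤n))) (a-gap j A<γ+j j<A)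

  ⋆-gapBelow : ∀ {a b A B α β γ} → VanishesAbove a A → GapBelow a A α → VanishesAbove b B → GapBelow b B β →
               γ ≤ α * B → γ ≤ A * β → GapBelow (a ⋆ b) (A * B) γ
  -- A surviving term a x · b y has y ≤ B; then x + α ≤ A would give x y ≤ A B − γ, while x = A
  -- puts y in the gap of b.
  ⋆-gapBelow {a} {b} {A} {B} {α} {β} {γ} a↑ a-gap b↑ b-gap γ≤αB γ≤Aβ i AB<γ+i i<AB = ⋆-≈0 a b i vanish
    where
    open ≤-Reasoning
    vanish : ∀ x y → x * y ≡ i → a x ≈ 0# ⊎ b y ≈ 0#
    vanish x y refl with ≤-or-≈0 b↑ y
    ... | inj₂ by≈0 = inj₂ by≈0
    ... | inj₁ y≤B with A <? α + x
    ...   | no A≮α+x = contradiction AB<γ+i (≤⇒≯ (begin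
            γ + x * y      ≤⟨ +-mono-≤ γ≤αB (*-monoʳ-≤ x y≤B) ⟩
            α * B + x * B  ≡⟨ *-distribʳ-+ B α x ⟨
            (α + x) * B    ≤⟨ *-monoˡ-≤ B (≮⇒≥ A≮α+x) ⟩
            A * B          ∎))
    ...   | yes A<α+x with <-cmp x A
    ...     | tri< x<A _ _  = inj₁ (a-gap x A<α+x x<A)
    ...     | tri> _ _ A<x  = inj₁ (a↑ x A<x)
    ...     | tri≈ _ refl _ = inj₂ (b-gap y B<β+y (*-cancelˡ-< A y B i<AB))
      where
      B<β+y : B < β + y
      B<β+y = *-cancelˡ-< A B (β + y) (begin-strict
        A * B          <⟨ AB<γ+i ⟩
        γ + A * y      ≤⟨ +-monoˡ-≤ (A * y) γ≤Aβ ⟩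
        A * β + A * y  ≡⟨ *-distribˡ-+ A β y ⟨
        A * (β + y)    ∎)

  ^⋆-gapBelow : ∀ {g d} → VanishesAbove g d → ∀ K → GapBelow (g ^⋆ suc K) (d ^ suc K) (d ^ K)
  ^⋆-gapBelow {g} {d} g↑ zero    = gapBelow-1 (g ^⋆ 1) (d ^ 1)
  ^⋆-gapBelow {g} {d} g↑ (suc K) =
    ⋆-gapBelow g↑ (gapBelow-1 g d) (^⋆-vanishesAbove g↑ (suc K)) (^⋆-gapBelow g↑ K)
               (≤-reflexive (sym (*-identityˡ (d ^ suc K)))) ≤-refl

  vanishesAbove-pred : ∀ {a N} → VanishesAbove a (suc N) → a (suc N) ≈ 0# → VanishesAbove a N
  vanishesAbove-pred {N = N} a↑ a[1+N]≈0 i N<i with i ≟ suc N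
  ... | yes refl    = a[1+N]≈0
  ... | no  i≢1+N   = a↑ i (≤∧≢⇒< N<i (i≢1+N ∘ sym))

  DegreeAbove-or-VanishesAbove : Series → ℕ → Set ℓ
  DegreeAbove-or-VanishesAbove a L = VanishesAbove a L ⊎ ∃[ d ] L < d × HasDegree a d

  hasDegree⇒degreeAbove-or-vanishesAbove : ∀ {a d} L → HasDegree a d → DegreeAbove-or-VanishesAbove a L
  hasDegree⇒degreeAbove-or-vanishesAbove {d = d} L (ad≉0 , a↑) with L <? d
  ... | yes L<d = inj₂ (d , L<d , ad≉0 , a↑)
  ... | no  L≮d = inj₁ λ i L<i → a↑ i (≤-<-trans (≮⇒≥ L≮d) L<i)

  -- Whether a coefficient vanishes is undecidable in R, so a degree is only found under a double
  -- negation; that suffices because PowerFree is itself a negation.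
  ¬¬-degreeAbove-or-vanishesAbove : ∀ {a} L N → VanishesAbove a N → ¬ ¬ DegreeAbove-or-VanishesAbove a L
  ¬¬-degreeAbove-or-vanishesAbove L zero    a↑ done = done (inj₁ λ i L<i → a↑ i (≤-<-trans z≤n L<i))
  ¬¬-degreeAbove-or-vanishesAbove L (suc M) a↑ done = ¬¬-excluded-middle λ where
    (yes a[1+M]≈0) → ¬¬-degreeAbove-or-vanishesAbove L M (vanishesAbove-pred a↑ a[1+M]≈0) done
    (no  a[1+M]≉0) → done (hasDegree⇒degreeAbove-or-vanishesAbove L (a[1+M]≉0 , a↑))

  module _ (1≉0 : ¬ 1# ≈ 0#) (noZeroDivisors : ∀ x y → x · y ≈ 0# → x ≈ 0# ⊎ y ≈ 0#) where

    ⋆-hasDegree : ∀ {a b A B} .{{_ : NonZero A}} .{{_ : NonZero B}} →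
                  HasDegree a A → HasDegree b B → HasDegree (a ⋆ b) (A * B)
    ⋆-hasDegree (aA≉0 , a↑) (bB≉0 , b↑) =
      (λ top≈0 → [ aA≉0 , bB≉0 ]′ (noZeroDivisors _ _ (R.trans (R.sym (⋆-top a↑ b↑)) top≈0))) ,
      ⋆-vanishesAbove a↑ b↑

    ^⋆-hasDegree : ∀ {g d} .{{_ : NonZero d}} → HasDegree g d → ∀ k → HasDegree (g ^⋆ k) (d ^ k)
    ^⋆-hasDegree         deg-g zero    = 1≉0 , one-vanishesAbove
    ^⋆-hasDegree {d = d} deg-g (suc k) = ⋆-hasDegree deg-g (^⋆-hasDegree deg-g k)
      where instance _ = m^n≢0 d k

    power-multiple-gap : ∀ {g h f d e n K γ} .{{_ : NonZero d}} .{{_ : NonZero e}} .{{_ : NonZero n}} →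
                         HasDegree g d → HasDegree h e → ((g ^⋆ suc K) ⋆ h) ≈D f → HasDegree f n →
                         n ≡ d ^ suc K * e × (γ ≤ d ^ K * e → γ ≤ d ^ suc K → GapBelow f n γ)
    power-multiple-gap {g} {h} {f} {d} {e} {n} {K} {γ} deg-g deg-h gᵏ⋆h≈f deg-f = n≡dᵏe , gap
      where
      instance _ = m^n≢0 d (suc K)
      instance _ = m*n≢0 (d ^ suc K) e

      n≡dᵏe : n ≡ d ^ suc K * e
      n≡dᵏe = sym (hasDegree-unique gᵏ⋆h≈f (⋆-hasDegree (^⋆-hasDegree deg-g (suc K)) deg-h) deg-f)

      gap : γ ≤ d ^ K * e → γ ≤ d ^ suc K → GapBelow f n γ
      gap γ≤dᴷe γ≤dᵏ rewrite n≡dᵏe =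
        gapBelow-≈D gᵏ⋆h≈f (≤-trans γ≤dᵏ (m≤m*n (d ^ suc K) e))
          (⋆-gapBelow (^⋆-vanishesAbove (proj₂ deg-g) (suc K)) (^⋆-gapBelow (proj₂ deg-g) K)
                      (proj₂ deg-h) (gapBelow-1 h e) γ≤dᴷe (≤-trans γ≤dᵏ (≤-reflexive (sym (*-identityʳ _)))))

theorem7p3 : ∀ {c ℓ} (R : CommutativeRing c ℓ) → IsUFD R →
    (k n q : ℕ) → 2 ≤ k → 1 ≤ n →
    Prime q → q ^ k ∣ n → (∀ p → Prime p → p ^ k ∣ n → q ≤ p) →
    (f : ℕ → CommutativeRing.Carrier R) → DP.HasDegree R f n →
    (∃ λ i → (n < i + (nBelow k n ⊓ q) * q ^ (k ∸ 1)) × (i < n) ×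
       ¬ (CommutativeRing._≈_ R (f i) (CommutativeRing.0# R))) →
    DP.PowerFree R k f
theorem7p3 R ufd (suc K) n q (s≤s _) 1≤n _ _ q-least f deg-f (i , n<i+γ , i<n , fi≉0)
           (g , (_ , g↑) , g-nonconstant , h , (_ , h↑) , gᵏ⋆h≈f) =
  ¬¬-degreeAbove-or-vanishesAbove 1 _ g↑ λ where
    (inj₁ g-constant) → g-nonconstant g-constant
    (inj₂ (d , 1<d , deg-g)) → ¬¬-degreeAbove-or-vanishesAbove 0 _ h↑ λ where
      (inj₁ h≈0) → proj₁ deg-f (vanishesAbove-≈D gᵏ⋆h≈f
        (⋆-vanishesAbove (^⋆-vanishesAbove (proj₂ deg-g) (suc K)) h≈0)
        n (subst (_< n) (sym (*-zeroʳ (d ^ suc K))) 1≤n))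
      (inj₂ (e , 0<e , deg-h)) →
        let instance
              _ = >-nonZero (<-trans z<s 1<d)
              _ = >-nonZero 0<e
              _ = >-nonZero 1≤n
            n≡dᵏe , gap = power-multiple-gap 1≉0 noZeroDivisors {K = K} deg-g deg-h gᵏ⋆h≈f deg-f
            γ≤dᴷe , γ≤dᵏ = gap-width-bounds {K} n≡dᵏe 1<d q-least
        in fi≉0 (gap γ≤dᴷe γ≤dᵏ i (subst (n <_) (+-comm i _) n<i+γ) i<n)
  where
  open IsUFD ufd
  open DirichletDegree R
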